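{- Let $\mathcal F\subseteq\mathcal P([n])$ be a diamond-saturated family with $\emptyset\notin\mathcal F$ and $[n]\notin\mathcal F$. Let $\mathcal B$ be the set of maximal elements of $\mathcal F$; let $\mathcal A_0$ be the set of $X\in\mathcal P([n])$ for which there exist $P,Q,R\in\mathcal F$ such that $R,P,Q,X$ form an induced diamond with $X$ as its maximal element; let $\mathcal A_1$ be the set of minimal elements of $\mathcal A_0$; and let $\mathcal A=\{X\in\mathcal A_1: X \text{ contains no set of }\mathcal B\text{ as a subset}\}$. Then $\mathcal A$ and $\mathcal B$ are disjoint, and $\mathcal A\cup\mathcal B$ is a $C_2$-saturated family in $\mathcal P([n])$.
   Context: $\mathcal P([n])$ is ordered by inclusion. Four distinct sets $R,P,Q,X$ form an induced diamond with $X$ maximal if $R\subsetneq P\subsetneq X$, $R\subsetneq Q\subsetneq X$ and $P,Q$ are incomparable. $\mathcal F$ is diamond-saturated if it contains no induced diamond (four sets of $\mathcal F$ in this configuration) but for every $S\notin\mathcal F$, $\mathcal F\cup\{S\}$ contains one. $C_2$ is the 2-element chain; a family is $C_2$-saturated if it contains no two distinct comparable sets (i.e. is an antichain), but adding any set not in the family creates two distinct comparable sets. -}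

module Defs where

open import Data.Nat using (ℕ)
open import Data.Fin.Subset using (Subset; _⊆_; _⊂_; _⊈_)
open import Data.Product using (_×_; ∃-syntax)
open import Data.Sum using (_⊎_)
open import Relation.Binary.PropositionalEquality using (_≡_; _≢_)
open import Relation.Nullary using (¬_)

-- A family of subsets of [n] = P([n]) is a predicate on Subset n
-- (Subset n ≅ P([n]), ordered by inclusion _⊆_; _⊂_ is proper inclusion).
Family : ℕ → Set₁
Family n = Subset n → Set

_∪｛_｝ : ∀ {n} → Family n → Subset n → Family n
(F ∪｛ S ｝) T = F T ⊎ T ≡ S

_∪ᶠ_ : ∀ {n} → Family n → Family n → Family n
(F ∪ᶠ G) T = F T ⊎ G T

-- R,P,Q,X form an induced diamond with X maximal
-- (distinctness of the four sets follows from the strict inclusions and incomparability)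
InducedDiamond : ∀ {n} → Subset n → Subset n → Subset n → Subset n → Set
InducedDiamond R P Q X =
  R ⊂ P × P ⊂ X × R ⊂ Q × Q ⊂ X × P ⊈ Q × Q ⊈ P

HasDiamond : ∀ {n} → Family n → Set
HasDiamond F = ∃[ R ] ∃[ P ] ∃[ Q ] ∃[ X ]
  (F R × F P × F Q × F X × InducedDiamond R P Q X)

DiamondSaturated : ∀ {n} → Family n → Set
DiamondSaturated F =
  ¬ HasDiamond F × (∀ S → ¬ F S → HasDiamond (F ∪｛ S ｝))

HasC2 : ∀ {n} → Family n → Set
HasC2 F = ∃[ X ] ∃[ Y ] (F X × F Y × X ⊆ Y × X ≢ Y)

C2Saturated : ∀ {n} → Family n → Set
C2Saturated F = ¬ HasC2 F × (∀ S → ¬ F S → HasC2 (F ∪｛ S ｝))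

Maximal : ∀ {n} → Family n → Family n
Maximal F X = F X × (∀ Y → F Y → ¬ X ⊂ Y)

Minimal : ∀ {n} → Family n → Family n
Minimal F X = F X × (∀ Y → F Y → ¬ Y ⊂ X)

A₀ : ∀ {n} → Family n → Family n
A₀ F X = ∃[ P ] ∃[ Q ] ∃[ R ] (F P × F Q × F R × InducedDiamond R P Q X)

A₁ : ∀ {n} → Family n → Family n
A₁ F = Minimal (A₀ F)

𝓑 : ∀ {n} → Family n → Family n
𝓑 F = Maximal F

𝓐 : ∀ {n} → Family n → Family n
𝓐 F X = A₁ F X × (∀ B → 𝓑 F B → ¬ B ⊆ X)

-- The maximal sets of F already form an antichain, and every set of 𝓐 is the top
-- of a diamond whose lower three sets lie in F; so a member of 𝓑 above it would be
-- the top of a diamond in F, and 𝓐 ∪ 𝓑 is an antichain. For saturation, take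
-- S ∉ 𝓐 ∪ 𝓑. If S ∈ F, it lies below a maximal set of F. Otherwise adding S to F
-- creates a diamond: either S is one of its three lower sets, hence strictly below
-- a member of F and so below a member of 𝓑, or S is its top, i.e. S ∈ 𝓐₀; then a
-- minimal Y ⊆ S of 𝓐₀ either contains a member of 𝓑 or itself belongs to 𝓐.
module Submission where

open import Defs
open import Data.Nat using (ℕ)
open import Data.Fin.Subset using (Subset; _⊆_; _⊂_; ⊥; ⊤)
open import Data.Fin.Subset.Properties
  using (_∈?_; _⊆?_; _⊂?_; ⊆-refl; ⊆-trans; ⊆-antisym; ⊂-trans; ⊂-irref; ⊂-⊆-trans; anySubset?)
open import Data.Fin.Subset.Induction using (⊂-wellFounded; ⊃-wellFounded; Acc; acc)
open import Data.Fin.Properties using (any?)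
open import Data.Product using (_×_; _,_; proj₁; proj₂; ∃-syntax)
open import Data.Sum using (_⊎_; inj₁; inj₂)
open import Data.Empty using (⊥-elim)
open import Relation.Nullary using (¬_; Dec; yes; no; ¬?; _×-dec_)
open import Relation.Nullary.Decidable using (decidable-stable)
open import Relation.Unary using (Decidable)
open import Relation.Binary.PropositionalEquality using (_≢_; refl; sym; subst)

module _ {n : ℕ} where

  ⊆∧≢⇒⊂ : {X Y : Subset n} → X ⊆ Y → X ≢ Y → X ⊂ Y
  ⊆∧≢⇒⊂ {X} {Y} X⊆Y X≢Y with any? (λ x → (x ∈? Y) ×-dec ¬? (x ∈? X))
  ... | yes new = X⊆Y , new
  ... | no ∄new = ⊥-elim (X≢Y (⊆-antisym X⊆Y (λ {x} x∈Y →
          decidable-stable (x ∈? X) (λ x∉X → ∄new (x , x∈Y , x∉X)))))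

  minimal-⊆ : (G : Family n) → Decidable G → ∀ X → G X → ∃[ Y ] (Minimal G Y × Y ⊆ X)
  minimal-⊆ G G? X = go X (⊂-wellFounded X)
    where
    go : ∀ X → Acc _⊂_ X → G X → ∃[ Y ] (Minimal G Y × Y ⊆ X)
    go X (acc below) gX with anySubset? (λ Y → G? Y ×-dec Y ⊂? X)
    ... | yes (Y , gY , Y⊂X) =
          let (Z , minZ , Z⊆Y) = go Y (below Y⊂X) gY in Z , minZ , ⊆-trans Z⊆Y (proj₁ Y⊂X)
    ... | no ∄Y = X , (gX , λ Y gY Y⊂X → ∄Y (Y , gY , Y⊂X)) , ⊆-refl

  maximal-⊇ : (G : Family n) → Decidable G → ∀ X → G X → ∃[ Y ] (Maximal G Y × X ⊆ Y)
  maximal-⊇ G G? X = go X (⊃-wellFounded X)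
    where
    go : ∀ X → Acc (λ A B → B ⊂ A) X → G X → ∃[ Y ] (Maximal G Y × X ⊆ Y)
    go X (acc above) gX with anySubset? (λ Y → G? Y ×-dec X ⊂? Y)
    ... | yes (Y , gY , X⊂Y) =
          let (Z , maxZ , Y⊆Z) = go Y (above X⊂Y) gY in Z , maxZ , ⊆-trans (proj₁ X⊂Y) Y⊆Z
    ... | no ∄Y = X , (gX , λ Y gY X⊂Y → ∄Y (Y , gY , X⊂Y)) , ⊆-refl

  maximal? : (G : Family n) → Decidable G → Decidable (Maximal G)
  maximal? G G? X with G? X | anySubset? (λ Y → G? Y ×-dec X ⊂? Y)
  ... | no ¬gX | _                  = no (λ maxX → ¬gX (proj₁ maxX))
  ... | yes _  | yes (Y , gY , X⊂Y) = no (λ maxX → proj₂ maxX Y gY X⊂Y)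
  ... | yes gX | no ∄Y              = yes (gX , λ Y gY X⊂Y → ∄Y (Y , gY , X⊂Y))

  inducedDiamond? : ∀ (R P Q X : Subset n) → Dec (InducedDiamond R P Q X)
  inducedDiamond? R P Q X =
    R ⊂? P ×-dec P ⊂? X ×-dec R ⊂? Q ×-dec Q ⊂? X ×-dec ¬? (P ⊆? Q) ×-dec ¬? (Q ⊆? P)

  A₀? : (F : Family n) → Decidable F → Decidable (A₀ F)
  A₀? F F? X = anySubset? λ P → anySubset? λ Q → anySubset? λ R →
    F? P ×-dec F? Q ×-dec F? R ×-dec inducedDiamond? R P Q X

  InducedDiamond-raiseTop : ∀ {R P Q X Y : Subset n} →
    InducedDiamond R P Q X → X ⊆ Y → InducedDiamond R P Q Y
  InducedDiamond-raiseTop (R⊂P , P⊂X , R⊂Q , Q⊂X , P⊈Q , Q⊈P) X⊆Y =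
    R⊂P , ⊂-⊆-trans P⊂X X⊆Y , R⊂Q , ⊂-⊆-trans Q⊂X X⊆Y , P⊈Q , Q⊈P

  A₀-⊆ : ∀ {F : Family n} {X Y} → A₀ F X → X ⊆ Y → A₀ F Y
  A₀-⊆ (P , Q , R , fP , fQ , fR , d) X⊆Y = P , Q , R , fP , fQ , fR , InducedDiamond-raiseTop d X⊆Y

  A₀∧F⇒HasDiamond : ∀ {F : Family n} {X} → A₀ F X → F X → HasDiamond F
  A₀∧F⇒HasDiamond (P , Q , R , fP , fQ , fR , d) fX = R , P , Q , _ , fR , fP , fQ , fX , d

  HasDiamond-∪｛｝⁻ : ∀ {F : Family n} {S} → ¬ HasDiamond F → HasDiamond (F ∪｛ S ｝) →
    A₀ F S ⊎ ∃[ X ] (F X × S ⊂ X)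
  HasDiamond-∪｛｝⁻ {F} {S} _ (R , P , Q , _ , mR , mP , mQ , inj₂ refl , d@(R⊂P , P⊂S , _ , Q⊂S , _)) =
    inj₁ (P , Q , R , old mP P⊂S , old mQ Q⊂S , old mR (⊂-trans R⊂P P⊂S) , d)
    where
    old : ∀ {T} → (F ∪｛ S ｝) T → T ⊂ S → F T
    old (inj₁ fT) _   = fT
    old (inj₂ refl) S⊂S = ⊥-elim (⊂-irref refl S⊂S)
  HasDiamond-∪｛｝⁻ {F} {S} noD (R , P , Q , X , mR , mP , mQ , inj₁ fX , d@(R⊂P , P⊂X , _ , Q⊂X , _)) =
    inj₂ (X , fX , S⊂X mR mP mQ)
    where
    S⊂X : (F ∪｛ S ｝) R → (F ∪｛ S ｝) P → (F ∪｛ S ｝) Q → S ⊂ X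
    S⊂X (inj₂ refl) _ _ = ⊂-trans R⊂P P⊂X
    S⊂X _ (inj₂ refl) _ = P⊂X
    S⊂X _ _ (inj₂ refl) = Q⊂X
    S⊂X (inj₁ fR) (inj₁ fP) (inj₁ fQ) = ⊥-elim (noD (R , P , Q , X , fR , fP , fQ , fX , d))

  𝓐∪𝓑-antichain : ∀ {F : Family n} → ¬ HasDiamond F → ¬ HasC2 (𝓐 F ∪ᶠ 𝓑 F)
  𝓐∪𝓑-antichain {F} noDiamond (X , Y , inX , inY , X⊆Y , X≢Y) = comparable inX inY
    where
    comparable : (𝓐 F ∪ᶠ 𝓑 F) X → ¬ (𝓐 F ∪ᶠ 𝓑 F) Y
    comparable (inj₁ aX) (inj₁ aY) = proj₂ (proj₁ aY) X (proj₁ (proj₁ aX)) (⊆∧≢⇒⊂ X⊆Y X≢Y)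
    comparable (inj₂ bX) (inj₂ bY) = proj₂ bX Y (proj₁ bY) (⊆∧≢⇒⊂ X⊆Y X≢Y)
    comparable (inj₂ bX) (inj₁ aY) = proj₂ aY X bX X⊆Y
    comparable (inj₁ aX) (inj₂ bY) = noDiamond (A₀∧F⇒HasDiamond (A₀-⊆ (proj₁ (proj₁ aX)) X⊆Y) (proj₁ bY))

  HasC2-add-above : ∀ {H : Family n} {S T} → H T → ¬ H S → T ⊆ S → HasC2 (H ∪｛ S ｝)
  HasC2-add-above {H} hT ¬hS T⊆S = _ , _ , inj₁ hT , inj₂ refl , T⊆S , λ T≡S → ¬hS (subst H T≡S hT)

  HasC2-add-below : ∀ {H : Family n} {S T} → H T → ¬ H S → S ⊆ T → HasC2 (H ∪｛ S ｝)
  HasC2-add-below {H} hT ¬hS S⊆T = _ , _ , inj₂ refl , inj₁ hT , S⊆T , λ S≡T → ¬hS (subst H (sym S≡T) hT)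

module _ {n : ℕ} (F : Family n) (F? : Decidable F) where

  private
    G : Family n
    G = 𝓐 F ∪ᶠ 𝓑 F

  below-F⇒HasC2 : ∀ {S X} → F X → S ⊆ X → ¬ G S → HasC2 (G ∪｛ S ｝)
  below-F⇒HasC2 {S} {X} fX S⊆X ¬gS =
    let (B , maxB , X⊆B) = maximal-⊇ F F? X fX
    in HasC2-add-below (inj₂ maxB) ¬gS (⊆-trans S⊆X X⊆B)

  A₀⇒HasC2 : ∀ {S} → A₀ F S → ¬ G S → HasC2 (G ∪｛ S ｝)
  A₀⇒HasC2 {S} a₀S ¬gS with minimal-⊆ (A₀ F) (A₀? F F?) S a₀S
  ... | Y , minY , Y⊆S with anySubset? (λ B → maximal? F F? B ×-dec B ⊆? Y)
  ...   | yes (B , maxB , B⊆Y) = HasC2-add-above (inj₂ maxB) ¬gS (⊆-trans B⊆Y Y⊆S)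
  ...   | no ∄B = HasC2-add-above (inj₁ (minY , noneBelow)) ¬gS Y⊆S
    where
    noneBelow : ∀ B → 𝓑 F B → ¬ B ⊆ Y
    noneBelow B maxB B⊆Y = ∄B (B , maxB , B⊆Y)

  𝓐∪𝓑-saturating : DiamondSaturated F → ∀ S → ¬ G S → HasC2 (G ∪｛ S ｝)
  𝓐∪𝓑-saturating (noDiamond , saturated) S ¬gS with F? S
  ... | yes fS = below-F⇒HasC2 fS ⊆-refl ¬gS
  ... | no ¬fS with HasDiamond-∪｛｝⁻ noDiamond (saturated S ¬fS)
  ...   | inj₁ a₀S            = A₀⇒HasC2 a₀S ¬gS
  ...   | inj₂ (X , fX , S⊂X) = below-F⇒HasC2 fX (proj₁ S⊂X) ¬gS

lemma2 : (n : ℕ) (F : Family n) → (∀ S → Dec (F S)) →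
    DiamondSaturated F → ¬ F ⊥ → ¬ F ⊤ →
    (∀ X → 𝓐 F X → ¬ 𝓑 F X) × C2Saturated (𝓐 F ∪ᶠ 𝓑 F)
lemma2 n F F? saturated _ _ =
  (λ X aX bX → proj₂ aX X bX ⊆-refl) ,
  𝓐∪𝓑-antichain (proj₁ saturated) ,
  𝓐∪𝓑-saturating F F? saturated
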